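{- Let $G$ and $H$ be regular graphs with vertex degrees $d_G$ and $d_H$. Let $x_1,x_2\in V(G)$ with $N_G[x_1]=N_G[x_2]$ and let $y_1y_2\in E(H)$. Then \[ \mathrm{OPT}_{G\boxtimes H}\big((x_1,y_1),(x_2,y_2)\big)=(d_G+1)\,\mathrm{OPT}_H(y_1,y_2). \]
   Context: Graphs are simple, undirected, locally finite; $d(\cdot,\cdot)$ is the shortest-path distance in the graph under consideration, $N(x)$ the neighbour set, $N[x]=N(x)\cup\{x\}$. For an edge $uv$ of a graph $K$: $\triangle(u,v)=N(u)\cap N(v)$, $R_u(u,v)=N(u)\setminus(\triangle(u,v)\cup\{v\})$, $R_v(u,v)=N(v)\setminus(\triangle(u,v)\cup\{u\})$. When $u,v$ have equal degree, $|R_u(u,v)|=|R_v(u,v)|$; an assignment is a bijection $\phi:R_u(u,v)\to R_v(u,v)$, and $\mathrm{OPT}_K(u,v)=\min_{\phi}\sum_{z\in R_u(u,v)}d_K(z,\phi(z))$ over all assignments. The strong product $G\boxtimes H$ has vertex set $V(G)\times V(H)$, with distinct $(x_1,y_1),(x_2,y_2)$ adjacent iff $x_2\in N_G[x_1]$ and $y_2\in N_H[y_1]$; distances in $\mathrm{OPT}_{G\boxtimes H}$ are taken in $G\boxtimes H$. -}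

module Defs where

open import Data.Nat using (ℕ; zero; suc; _+_; _<_; _≤_)
open import Data.Product using (Σ; ∃; ∃-syntax; _×_; _,_)
open import Data.Sum using (_⊎_; inj₁; inj₂)
open import Data.List using (List; []; _∷_; length)
open import Data.List.Membership.Propositional using (_∈_)
open import Data.List.Relation.Unary.Unique.Propositional using (Unique)
open import Function.Bundles using (_⇔_)
open import Relation.Nullary using (¬_)
open import Relation.Binary.PropositionalEquality using (_≡_; _≢_; refl; sym)

record Graph : Set₁ where
  field
    V      : Set
    Adj    : V → V → Set
    adj-sym    : ∀ {x y} → Adj x y → Adj y x
    adj-irrefl : ∀ {x} → ¬ Adj x x

open Graph public

ClosedNbr : (G : Graph) → V G → V G → Set
ClosedNbr G x w = (w ≡ x) ⊎ Adj G x w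

Enumerates : (G : Graph) → (V G → Set) → List (V G) → Set
Enumerates G P l = Unique l × (∀ z → (z ∈ l) ⇔ P z)

Regular : Graph → ℕ → Set
Regular G d = ∀ x → ∃[ l ] (Enumerates G (Adj G x) l × length l ≡ d)

data Walk (G : Graph) : V G → V G → ℕ → Set where
  here : ∀ {x} → Walk G x x zero
  step : ∀ {x y z n} → Adj G x y → Walk G y z n → Walk G x z (suc n)

Dist : (G : Graph) → V G → V G → ℕ → Set
Dist G x y n = Walk G x y n × (∀ m → m < n → ¬ Walk G x y m)

InR : (G : Graph) → V G → V G → V G → Set
InR G u v z = Adj G u z × ¬ (Adj G u z × Adj G v z) × z ≢ v

data PairCost (G : Graph) : List (V G) → List (V G) → ℕ → Set where
  nil  : PairCost G [] [] zero
  cons : ∀ {x y xs ys k c} → Dist G x y k → PairCost G xs ys c →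
         PairCost G (x ∷ xs) (y ∷ ys) (k + c)

-- An assignment φ : R_u(u,v) → R_v(u,v) is given by duplicate-free enumerations
-- as of R_u and bs of R_v (of equal length), φ(as[i]) = bs[i]; every bijection arises so.
AssignCost : (G : Graph) → V G → V G → ℕ → Set
AssignCost G u v c =
  ∃[ as ] ∃[ bs ] (Enumerates G (InR G u v) as × Enumerates G (InR G v u) bs
                   × PairCost G as bs c)

IsOPT : (G : Graph) → V G → V G → ℕ → Set
IsOPT G u v c = Adj G u v × AssignCost G u v c × (∀ c' → AssignCost G u v c' → c ≤ c')

⊠-Adj : (G H : Graph) → V G × V H → V G × V H → Set
⊠-Adj G H (x₁ , y₁) (x₂ , y₂) =
  ((x₁ , y₁) ≢ (x₂ , y₂)) × ClosedNbr G x₁ x₂ × ClosedNbr H y₁ y₂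

private
  cn-sym : ∀ (G : Graph) {x w} → ClosedNbr G x w → ClosedNbr G w x
  cn-sym G (inj₁ refl) = inj₁ refl
  cn-sym G (inj₂ a) = inj₂ (adj-sym G a)

_⊠_ : Graph → Graph → Graph
G ⊠ H = record
  { V = V G × V H
  ; Adj = ⊠-Adj G H
  ; adj-sym = λ { (ne , a , b) → (λ e → ne (sym e)) , cn-sym G a , cn-sym H b }
  ; adj-irrefl = λ { (ne , _ , _) → ne refl }
  }

{-# OPTIONS --safe #-}
-- Because x₁ and x₂ are twins, R((x₁,y₁),(x₂,y₂)) = N[x₁] × R(y₁,y₂) and
-- R((x₂,y₂),(x₁,y₁)) = N[x₁] × R(y₂,y₁), and the distance between two vertices of G ⊠ H is at
-- least the distance of their H-coordinates, with equality inside a fibre {x} × V(H).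
-- Copying an optimal assignment of H into each of the d_G + 1 fibres gives the upper bound.
-- Conversely, projecting any assignment of G ⊠ H to H gives a (d_G + 1)-regular bipartite
-- multigraph between R(y₁,y₂) and R(y₂,y₁) of no larger cost. Index both sides so that an optimal
-- assignment of H is the diagonal i ↦ i; the multigraph splits into cycles, a cycle completed by
-- diagonal pairs is an assignment, so by optimality each cycle costs at least its diagonal part,
-- and summing gives (d_G + 1) OPT_H.
-- Adjacency is not decidable, so the distances of H exist only under double negation; this is
-- harmless because the lower bound is a decidable inequality.
module Submission where

open import Defs
open import Data.Nat using (ℕ; zero; suc; _+_; _*_; _≤_; _<_; _≤?_; z≤n; s≤s)
open import Data.Nat.Properties
open import Data.Nat.Induction using (<-wellFounded)
open import Data.Nat.ListAction using (sum)
open import Data.Nat.ListAction.Properties using (sum-++; sum-↭)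
open import Data.Fin using (Fin)
open import Data.Fin.Properties using () renaming (_≟_ to _≟ᶠ_)
open import Data.Product using (Σ; ∃-syntax; _×_; _,_; proj₁; proj₂; uncurry)
open import Data.Sum using (inj₁; inj₂)
open import Data.List using (List; []; _∷_; [_]; _++_; length; map; tabulate; lookup; allFin; cartesianProduct)
open import Data.List.Properties using (++-assoc; length-++; length-tabulate; map-++; map-∘; map-id; map-injective; map-tabulate; tabulate-lookup)
open import Data.List.Membership.Propositional using (_∈_)
open import Data.List.Membership.Propositional.Properties using (∈-∃++; ∈-map⁺; ∈-map⁻; ∈-allFin; ∈-tabulate⁺; ∈-tabulate⁻; ∈-cartesianProduct⁺; ∈-cartesianProduct⁻)
open import Data.List.Membership.Propositional.Properties.WithK using (unique∧set⇒bag)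
open import Data.List.Relation.Binary.BagAndSetEquality using (∼bag⇒↭)
open import Data.List.Relation.Binary.Subset.Propositional using (_⊆_)
open import Data.List.Relation.Binary.Permutation.Propositional using (_↭_; ↭-refl; ↭-sym; ↭-trans; ↭-reflexive; prep; ↭⇒↭ₛ; module PermutationReasoning)
open import Data.List.Relation.Binary.Permutation.Propositional.Properties using (map⁺; ↭-map-inv; ↭-length; ∈-resp-↭; shift; drop-∷; ++⁺ʳ; ∷↭∷ʳ)
import Data.List.Relation.Binary.Permutation.Setoid.Properties as PermutationₛProperties
open import Data.List.Relation.Unary.All using (All; []; _∷_)
import Data.List.Relation.Unary.All as All
open import Data.List.Relation.Unary.All.Properties using (++⁻ˡ; ¬Any⇒All¬)
open import Data.List.Relation.Unary.AllPairs using ([]; _∷_)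
open import Data.List.Relation.Unary.Any using (here; there)
open import Data.List.Relation.Unary.Unique.Propositional using (Unique)
import Data.List.Relation.Unary.Unique.Propositional.Properties as Unique
open import Data.Empty using (⊥-elim)
open import Function using (_∘_; id; _⇔_; mk⇔; Equivalence)
open import Function.Properties.Equivalence using () renaming (sym to ⇔-sym; trans to ⇔-trans)
open import Induction.WellFounded using (Acc; acc)
open import Relation.Nullary using (¬_; yes; no; contradiction)
open import Relation.Nullary.Decidable using (decidable-stable)
open import Relation.Nullary.Negation using (¬¬-map)
open import Relation.Binary.PropositionalEquality using (_≡_; _≢_; refl; sym; trans; cong; cong₂; subst; subst₂; setoid; module ≡-Reasoning)

open Equivalence using (to; from)

module _ {A : Set} where

  ∈-∷⁻ : ∀ {x y : A} {xs} → y ∈ x ∷ xs → x ≢ y → y ∈ xs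
  ∈-∷⁻ (here refl) x≢y = ⊥-elim (x≢y refl)
  ∈-∷⁻ (there y∈xs) _  = y∈xs

  ⊆⇒↭-++ : ∀ {xs ys : List A} → Unique xs → xs ⊆ ys → ∃[ zs ] ys ↭ xs ++ zs
  ⊆⇒↭-++ {[]} {ys} [] _ = ys , ↭-refl
  ⊆⇒↭-++ {x ∷ xs} (x∉xs ∷ xs!) xs⊆ys with us , vs , refl ← ∈-∃++ (xs⊆ys (here refl)) =
    let zs , us++vs↭ = ⊆⇒↭-++ xs! xs⊆us++vs in zs , ↭-trans (shift x us vs) (prep x us++vs↭)
    where
    xs⊆us++vs : xs ⊆ us ++ vs
    xs⊆us++vs y∈xs = ∈-∷⁻ (∈-resp-↭ (shift x us vs) (xs⊆ys (there y∈xs))) (All.lookup x∉xs y∈xs)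

  unique-⇔⇒↭ : ∀ {xs ys : List A} → Unique xs → Unique ys → (∀ {z} → z ∈ xs ⇔ z ∈ ys) → xs ↭ ys
  unique-⇔⇒↭ xs! ys! xs⇔ys = ∼bag⇒↭ (unique∧set⇒bag xs! ys! xs⇔ys)

  Unique-resp-↭ : ∀ {xs ys : List A} → xs ↭ ys → Unique xs → Unique ys
  Unique-resp-↭ xs↭ys = PermutationₛProperties.Unique-resp-↭ (setoid A) (↭⇒↭ₛ xs↭ys)

  Unique-++⁻ˡ : ∀ (xs : List A) {ys} → Unique (xs ++ ys) → Unique xs
  Unique-++⁻ˡ []       _             = []
  Unique-++⁻ˡ (x ∷ xs) (x∉ ∷ xs++ys!) = ++⁻ˡ xs x∉ ∷ Unique-++⁻ˡ xs xs++ys!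

  ↭-cancelˡ : ∀ (xs : List A) {ys zs} → xs ++ ys ↭ xs ++ zs → ys ↭ zs
  ↭-cancelˡ []       ys↭zs = ys↭zs
  ↭-cancelˡ (x ∷ xs) ys↭zs = ↭-cancelˡ xs (drop-∷ ys↭zs)

  tabulate-injective : ∀ {n} {f : Fin n → A} → Unique (tabulate f) → ∀ {i j} → f i ≡ f j → i ≡ j
  tabulate-injective _ {Fin.zero} {Fin.zero} _ = refl
  tabulate-injective (f₀∉ ∷ _) {Fin.zero} {Fin.suc j} f₀≡fⱼ =
    contradiction f₀≡fⱼ (All.lookup f₀∉ (∈-tabulate⁺ j))
  tabulate-injective (f₀∉ ∷ _) {Fin.suc i} {Fin.zero} fᵢ≡f₀ =
    contradiction (sym fᵢ≡f₀) (All.lookup f₀∉ (∈-tabulate⁺ i))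
  tabulate-injective {f = f} (_ ∷ f!) {Fin.suc i} {Fin.suc j} fᵢ≡fⱼ =
    cong Fin.suc (tabulate-injective {f = f ∘ Fin.suc} f! fᵢ≡fⱼ)

  tabulate-↭ : ∀ {n} (f : Fin n → A) {is} → is ↭ allFin n → map f is ↭ tabulate f
  tabulate-↭ f is↭ = ↭-trans (map⁺ f is↭) (↭-reflexive (map-tabulate id f))

  ∃-tabulate : ∀ {n} (xs : List A) → length xs ≡ n → Σ (Fin n → A) λ f → tabulate f ≡ xs
  ∃-tabulate xs refl = lookup xs , tabulate-lookup xs

  copies : ℕ → List A → List A
  copies zero    xs = []
  copies (suc k) xs = xs ++ copies k xs

module _ {A B : Set} where

  proj₂-∈-cartesianProduct : ∀ (xs : List A) {ys : List B} {zs} →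
                             zs ↭ cartesianProduct xs ys → All (λ z → proj₂ z ∈ ys) zs
  proj₂-∈-cartesianProduct xs {ys} zs↭ =
    All.tabulate λ z∈zs → proj₂ (∈-cartesianProduct⁻ xs ys (∈-resp-↭ zs↭ z∈zs))

  ↭-map-injective : ∀ {f : A → B} → (∀ {x y} → f x ≡ f y → x ≡ y) →
                    ∀ {xs ys} → map f xs ↭ map f ys → xs ↭ ys
  ↭-map-injective {f} f-inj {xs} fxs↭fys with ys′ , fys≡fys′ , xs↭ys′ ← ↭-map-inv f fxs↭fys =
    subst (xs ↭_) (sym (map-injective f-inj fys≡fys′)) xs↭ys′

  map-copies : ∀ (f : A → B) k xs → map f (copies k xs) ≡ copies k (map f xs)
  map-copies f zero    xs = refl
  map-copies f (suc k) xs = trans (map-++ f xs (copies k xs)) (cong (map f xs ++_) (map-copies f k xs))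

  map-proj₂-cartesianProduct : ∀ (xs : List A) (ys : List B) →
                               map proj₂ (cartesianProduct xs ys) ≡ copies (length xs) ys
  map-proj₂-cartesianProduct []       ys = refl
  map-proj₂-cartesianProduct (x ∷ xs) ys = begin
    map proj₂ (map (x ,_) ys ++ cartesianProduct xs ys)
      ≡⟨ map-++ proj₂ (map (x ,_) ys) (cartesianProduct xs ys) ⟩
    map proj₂ (map (x ,_) ys) ++ map proj₂ (cartesianProduct xs ys)
      ≡⟨ cong₂ _++_ (trans (sym (map-∘ ys)) (map-id ys)) (map-proj₂-cartesianProduct xs ys) ⟩
    ys ++ copies (length xs) ys ∎
    where open ≡-Reasoning

module _ {A : Set} (f : A → ℕ) where

  sum-map-++ : ∀ xs ys → sum (map f (xs ++ ys)) ≡ sum (map f xs) + sum (map f ys)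
  sum-map-++ xs ys = trans (cong sum (map-++ f xs ys)) (sum-++ (map f xs) (map f ys))

  sum-map-↭ : ∀ {xs ys} → xs ↭ ys → sum (map f xs) ≡ sum (map f ys)
  sum-map-↭ xs↭ys = sum-↭ (map⁺ f xs↭ys)

  sum-map-copies : ∀ k xs → sum (map f (copies k xs)) ≡ k * sum (map f xs)
  sum-map-copies zero    xs = refl
  sum-map-copies (suc k) xs =
    trans (sum-map-++ xs (copies k xs)) (cong (sum (map f xs) +_) (sum-map-copies k xs))

indices-↭-copies : ∀ {A B : Set} {n} (X : List A) (f : Fin n → B) → Unique (tabulate f) → ∀ {is ws} →
                   map f is ≡ map proj₂ ws → ws ↭ cartesianProduct X (tabulate f) →
                   is ↭ copies (length X) (allFin n)
indices-↭-copies {n = n} X f f! {is} {ws} fis≡ ws↭ = ↭-map-injective (tabulate-injective f!) (begin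
  map f is                                     ≡⟨ fis≡ ⟩
  map proj₂ ws                                 ↭⟨ map⁺ proj₂ ws↭ ⟩
  map proj₂ (cartesianProduct X (tabulate f))  ≡⟨ map-proj₂-cartesianProduct X (tabulate f) ⟩
  copies (length X) (tabulate f)               ≡⟨ cong (copies (length X)) (map-tabulate id f) ⟨
  copies (length X) (map f (allFin n))         ≡⟨ map-copies f (length X) (allFin n) ⟨
  map f (copies (length X) (allFin n))         ∎)
  where open PermutationReasoning

¬¬-Π-Fin : ∀ {n} {B : Fin n → Set} → (∀ i → ¬ ¬ B i) → ¬ ¬ (∀ i → B i)
¬¬-Π-Fin {zero}  _   ¬∀ = ¬∀ λ ()
¬¬-Π-Fin {suc n} ¬¬B ¬∀ =
  ¬¬B Fin.zero λ B₀ → ¬¬-Π-Fin (¬¬B ∘ Fin.suc) λ Bₛ → ¬∀ λ { Fin.zero → B₀ ; (Fin.suc i) → Bₛ i }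

unique-length≤ : ∀ {n} {xs : List (Fin n)} → Unique xs → length xs ≤ n
unique-length≤ {n} {xs} xs! with rest , allFin↭ ← ⊆⇒↭-++ xs! (λ {i} _ → ∈-allFin i) = begin
  length xs               ≤⟨ m≤m+n _ _ ⟩
  length xs + length rest ≡⟨ length-++ xs ⟨
  length (xs ++ rest)     ≡⟨ ↭-length allFin↭ ⟨
  length (allFin n)       ≡⟨ length-tabulate id ⟩
  n                       ∎
  where open ≤-Reasoning

Twins : (G : Graph) → V G → V G → Set
Twins G x₁ x₂ = ∀ w → ClosedNbr G x₁ w ⇔ ClosedNbr G x₂ w

module _ {G : Graph} where

  dist-≤-walk : ∀ {a b k m} → Dist G a b k → Walk G a b m → k ≤ m
  dist-≤-walk (_ , minimal) w = ≮⇒≥ (λ m<k → minimal _ m<k w)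

  dist-unique : ∀ {a b k k′} → Dist G a b k → Dist G a b k′ → k ≡ k′
  dist-unique d d′ = ≤-antisym (dist-≤-walk d (proj₁ d′)) (dist-≤-walk d′ (proj₁ d))

  ¬¬-dist : ∀ {a b m} → Walk G a b m → ¬ ¬ (∃[ k ] Dist G a b k)
  ¬¬-dist {a} {b} w = go (<-wellFounded _) w
    where
    go : ∀ {m} → Acc _<_ m → Walk G a b m → ¬ ¬ (∃[ k ] Dist G a b k)
    go (acc shorter) w no-dist = no-dist (_ , w , λ _ j<m w′ → go (shorter j<m) w′ no-dist)

  PairCost-length : ∀ {xs ys c} → PairCost G xs ys c → length xs ≡ length ys
  PairCost-length nil          = refl
  PairCost-length (cons _ pc) = cong suc (PairCost-length pc)

  PairCost-unique : ∀ {xs ys c c′} → PairCost G xs ys c → PairCost G xs ys c′ → c ≡ c′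
  PairCost-unique nil          nil            = refl
  PairCost-unique (cons d pc) (cons d′ pc′) = cong₂ _+_ (dist-unique d d′) (PairCost-unique pc pc′)

  PairCost-++ : ∀ {xs ys c xs′ ys′ c′} → PairCost G xs ys c → PairCost G xs′ ys′ c′ →
                PairCost G (xs ++ xs′) (ys ++ ys′) (c + c′)
  PairCost-++                nil                    pc′ = pc′
  PairCost-++ {c′ = c′} (cons {k = k} {c = c} d pc) pc′ =
    subst (PairCost G _ _) (sym (+-assoc k c c′)) (cons d (PairCost-++ pc pc′))

module _ (G : Graph) where

  adj⇒≢ : ∀ {a b} → Adj G a b → a ≢ b
  adj⇒≢ a~a refl = adj-irrefl G a~a

  InR⇔ : ∀ {u v z} → InR G u v z ⇔ (Adj G u z × ¬ ClosedNbr G v z)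
  InR⇔ = mk⇔
    (λ (u~z , ¬both , z≢v) → u~z , λ { (inj₁ z≡v) → z≢v z≡v ; (inj₂ v~z) → ¬both (u~z , v~z) })
    (λ (u~z , z∉N[v]) → u~z , (λ (_ , v~z) → z∉N[v] (inj₂ v~z)) , z∉N[v] ∘ inj₁)

  Enumerates-⇔ : ∀ {P Q : V G → Set} {xs} → (∀ z → P z ⇔ Q z) → Enumerates G P xs → Enumerates G Q xs
  Enumerates-⇔ P⇔Q (xs! , ∈⇔P) = xs! , λ z → ⇔-trans (∈⇔P z) (P⇔Q z)

  Enumerates-↭ : ∀ {P : V G → Set} {xs ys} → Enumerates G P xs → xs ↭ ys → Enumerates G P ys
  Enumerates-↭ (xs! , ∈⇔P) xs↭ys =
    Unique-resp-↭ xs↭ys xs! , λ z → ⇔-trans (mk⇔ (∈-resp-↭ (↭-sym xs↭ys)) (∈-resp-↭ xs↭ys)) (∈⇔P z)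

  Enumerates-unique : ∀ {P : V G → Set} {xs ys} → Enumerates G P xs → Enumerates G P ys → xs ↭ ys
  Enumerates-unique (xs! , ∈xs⇔P) (ys! , ∈ys⇔P) =
    unique-⇔⇒↭ xs! ys! (⇔-trans (∈xs⇔P _) (⇔-sym (∈ys⇔P _)))

  AssignCost-tabulate : ∀ {u v c} → AssignCost G u v c →
    ∃[ n ] Σ (Fin n → V G) λ fa → Σ (Fin n → V G) λ fb →
      Enumerates G (InR G u v) (tabulate fa) × Enumerates G (InR G v u) (tabulate fb) ×
      PairCost G (tabulate fa) (tabulate fb) c
  AssignCost-tabulate (as , bs , as-enum , bs-enum , pc) =
    let fa , fa≡as = ∃-tabulate as refl
        fb , fb≡bs = ∃-tabulate bs (sym (PairCost-length pc))
    in _ , fa , fb ,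
       subst (Enumerates G _) (sym fa≡as) as-enum ,
       subst (Enumerates G _) (sym fb≡bs) bs-enum ,
       subst₂ (λ as bs → PairCost G as bs _) (sym fa≡as) (sym fb≡bs) pc

  Enumerates-closedNbr : ∀ {x xs} → Enumerates G (Adj G x) xs → Enumerates G (ClosedNbr G x) (x ∷ xs)
  Enumerates-closedNbr {x} (xs! , ∈⇔adj) =
    All.tabulate (λ z∈xs → adj⇒≢ (to (∈⇔adj _) z∈xs)) ∷ xs! ,
    λ z → mk⇔ (λ { (here z≡x) → inj₁ z≡x ; (there z∈xs) → inj₂ (to (∈⇔adj z) z∈xs) })
              (λ { (inj₁ z≡x) → here z≡x ; (inj₂ x~z) → there (from (∈⇔adj z) x~z) })

module DiagonalAssignment {n : ℕ} (D : Fin n → Fin n → ℕ) where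

  open import Data.List.Membership.DecPropositional (_≟ᶠ_ {n}) using (_∈?_)

  Arc : Set
  Arc = Fin n × Fin n

  sources targets : List Arc → List (Fin n)
  sources = map proj₁
  targets = map proj₂

  cost : List Arc → ℕ
  cost P = sum (map (uncurry D) P)

  diagonalCost : List (Fin n) → ℕ
  diagonalCost is = sum (map (λ i → D i i) is)

  loops : List (Fin n) → List Arc
  loops = map (λ i → i , i)

  Balanced : List Arc → Set
  Balanced P = sources P ↭ targets P

  IsPermutation : List Arc → Set
  IsPermutation Q = sources Q ↭ allFin n × targets Q ↭ allFin n

  DiagonalOptimal : Set
  DiagonalOptimal = ∀ Q → IsPermutation Q → diagonalCost (allFin n) ≤ cost Q

  sources-++ : ∀ P Q → sources (P ++ Q) ≡ sources P ++ sources Q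
  sources-++ = map-++ proj₁

  targets-++ : ∀ P Q → targets (P ++ Q) ≡ targets P ++ targets Q
  targets-++ = map-++ proj₂

  sources-loops : ∀ is → sources (loops is) ≡ is
  sources-loops is = trans (sym (map-∘ is)) (map-id is)

  targets-loops : ∀ is → targets (loops is) ≡ is
  targets-loops is = trans (sym (map-∘ is)) (map-id is)

  cost-loops : ∀ is → cost (loops is) ≡ diagonalCost is
  cost-loops is = cong sum (sym (map-∘ is))

  Balanced-++⁻ʳ : ∀ C {R} → Balanced (C ++ R) → Balanced C → Balanced R
  Balanced-++⁻ʳ C {R} C++R-balanced C-balanced = ↭-cancelˡ (sources C) (begin
    sources C ++ sources R ≡⟨ sources-++ C R ⟨
    sources (C ++ R)       ↭⟨ C++R-balanced ⟩
    targets (C ++ R)       ≡⟨ targets-++ C R ⟩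
    targets C ++ targets R ↭⟨ ++⁺ʳ (targets R) C-balanced ⟨
    sources C ++ targets R ∎)
    where open PermutationReasoning

  -- Completing C by loops at the indices it misses gives a permutation.
  cycle-bound : DiagonalOptimal → ∀ C → Unique (sources C) → Balanced C →
                diagonalCost (sources C) ≤ cost C
  cycle-bound optimal C sources! balanced with rest , allFin↭ ← ⊆⇒↭-++ sources! (λ {i} _ → ∈-allFin i) =
    +-cancelʳ-≤ (diagonalCost rest) _ _ (begin
      diagonalCost (sources C) + diagonalCost rest ≡⟨ sum-map-++ _ (sources C) rest ⟨
      diagonalCost (sources C ++ rest)            ≡⟨ sum-map-↭ _ allFin↭ ⟨
      diagonalCost (allFin n)                     ≤⟨ optimal (C ++ loops rest) completion ⟩
      cost (C ++ loops rest)                      ≡⟨ sum-map-++ _ C (loops rest) ⟩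
      cost C + cost (loops rest)                  ≡⟨ cong (cost C +_) (cost-loops rest) ⟩
      cost C + diagonalCost rest                  ∎)
    where
    open ≤-Reasoning
    completion : IsPermutation (C ++ loops rest)
    completion = ↭-trans (↭-reflexive (trans (sources-++ C (loops rest)) (cong (sources C ++_) (sources-loops rest))))
                         (↭-sym allFin↭)
               , ↭-trans (↭-reflexive (trans (targets-++ C (loops rest)) (cong (targets C ++_) (targets-loops rest))))
                         (↭-trans (++⁺ʳ rest (↭-sym balanced)) (↭-sym allFin↭))

  -- A trail a ∷ p lists its vertices latest first; it walks along the arcs (older , newer).
  trailArcs : List (Fin n) → List Arc
  trailArcs (a ∷ b ∷ p) = (b , a) ∷ trailArcs (b ∷ p)
  trailArcs _           = []

  sources-trailArcs : ∀ a p → sources (trailArcs (a ∷ p)) ≡ p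
  sources-trailArcs a []      = refl
  sources-trailArcs a (b ∷ p) = cong (b ∷_) (sources-trailArcs b p)

  targets-trailArcs : ∀ p w → targets (trailArcs (p ++ [ w ])) ≡ p
  targets-trailArcs []          w = refl
  targets-trailArcs (a ∷ [])    w = refl
  targets-trailArcs (a ∷ b ∷ p) w = cong (a ∷_) (targets-trailArcs (b ∷ p) w)

  trailArcs-++ : ∀ p q → trailArcs p ⊆ trailArcs (p ++ q)
  trailArcs-++ (a ∷ b ∷ p) q (here e)  = here e
  trailArcs-++ (a ∷ b ∷ p) q (there m) = there (trailArcs-++ (b ∷ p) q m)

  record Cycle (P : List Arc) : Set where
    field
      arcs           : List Arc
      nonempty       : 1 ≤ length arcs
      sources-unique : Unique (sources arcs)
      balanced       : Balanced arcs
      arcs⊆P         : arcs ⊆ P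

  close-trail : ∀ {P a w} ys zs → Unique (a ∷ ys ++ w ∷ zs) → trailArcs (a ∷ ys ++ w ∷ zs) ⊆ P →
                (a , w) ∈ P → Cycle P
  close-trail {a = a} {w} ys zs trail! trail⊆P aw∈P = record
    { arcs           = (a , w) ∷ trailArcs (a ∷ ys ++ [ w ])
    ; nonempty       = s≤s z≤n
    ; sources-unique = subst Unique (cong (a ∷_) (sym (sources-trailArcs a (ys ++ [ w ]))))
                         (Unique-++⁻ˡ (a ∷ ys ++ [ w ]) (subst Unique (sym trail≡) trail!))
    ; balanced       = subst₂ _↭_ (cong (a ∷_) (sym (sources-trailArcs a (ys ++ [ w ]))))
                                  (cong (w ∷_) (sym (targets-trailArcs (a ∷ ys) w)))
                                  (↭-sym (∷↭∷ʳ w (a ∷ ys)))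
    ; arcs⊆P         = λ { (here refl) → aw∈P ; (there m) → trail⊆P (trailArcs⊆ m) }
    }
    where
    trail≡ : (a ∷ ys ++ [ w ]) ++ zs ≡ a ∷ ys ++ w ∷ zs
    trail≡ = cong (a ∷_) (++-assoc ys [ w ] zs)
    trailArcs⊆ : trailArcs (a ∷ ys ++ [ w ]) ⊆ trailArcs (a ∷ ys ++ w ∷ zs)
    trailArcs⊆ {e} m = subst (λ t → e ∈ trailArcs t) trail≡ (trailArcs-++ (a ∷ ys ++ [ w ]) zs m)

  module _ {P : List Arc} (P-balanced : Balanced P) where

    -- A duplicate-free trail has at most n vertices, so the fuel never runs out.
    find-cycle : ∀ fuel a p → n < length (a ∷ p) + fuel → Unique (a ∷ p) →
                 trailArcs (a ∷ p) ⊆ P → a ∈ sources P → Cycle P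
    find-cycle zero a p long trail! _ _ =
      contradiction (subst (_≤ n) (sym (+-identityʳ _)) (unique-length≤ trail!)) (<⇒≱ long)
    find-cycle (suc fuel) a p long trail! trail⊆P a∈sources
      with (_ , w) , aw∈P , refl ← ∈-map⁻ proj₁ a∈sources
      with w ≟ᶠ a | w ∈? p
    ... | yes refl | _ = record
      { arcs = [ (a , a) ] ; nonempty = s≤s z≤n ; sources-unique = [] ∷ []
      ; balanced = ↭-refl ; arcs⊆P = λ { (here refl) → aw∈P } }
    ... | no _ | yes w∈p with ys , zs , refl ← ∈-∃++ w∈p = close-trail ys zs trail! trail⊆P aw∈P
    ... | no w≢a | no w∉p =
      find-cycle fuel w (a ∷ p) (subst (n <_) (+-suc _ fuel) long) ((w≢a ∷ ¬Any⇒All¬ p w∉p) ∷ trail!)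
        (λ { (here refl) → aw∈P ; (there m) → trail⊆P m })
        (∈-resp-↭ (↭-sym P-balanced) (∈-map⁺ proj₂ aw∈P))

  balanced-bound : DiagonalOptimal → ∀ P → Balanced P → diagonalCost (sources P) ≤ cost P
  balanced-bound optimal P = go P (<-wellFounded (length P))
    where
    go : ∀ P → Acc _<_ (length P) → Balanced P → diagonalCost (sources P) ≤ cost P
    go []          _             _          = z≤n
    go P@(e ∷ _)   (acc shorter) P-balanced
      with C ← find-cycle P-balanced n (proj₁ e) [] (n<1+n n) ([] ∷ []) (λ ()) (here refl)
      with R , P↭C++R ← ⊆⇒↭-++ (Unique.map⁻ (Cycle.sources-unique C)) (Cycle.arcs⊆P C) = begin
        diagonalCost (sources P)                               ≡⟨ sum-map-↭ _ (map⁺ proj₁ P↭C++R) ⟩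
        diagonalCost (sources (arcs ++ R))                     ≡⟨ cong diagonalCost (sources-++ arcs R) ⟩
        diagonalCost (sources arcs ++ sources R)               ≡⟨ sum-map-++ _ (sources arcs) (sources R) ⟩
        diagonalCost (sources arcs) + diagonalCost (sources R) ≤⟨ +-mono-≤ cycle-part rest-part ⟩
        cost arcs + cost R                                     ≡⟨ sum-map-++ _ arcs R ⟨
        cost (arcs ++ R)                                       ≡⟨ sum-map-↭ _ P↭C++R ⟨
        cost P                                                 ∎
      where
      open Cycle C
      open ≤-Reasoning
      R-balanced : Balanced R
      R-balanced = Balanced-++⁻ʳ arcs
        (↭-trans (↭-sym (map⁺ proj₁ P↭C++R)) (↭-trans P-balanced (map⁺ proj₂ P↭C++R))) balanced
      R-shorter : length R < length P
      R-shorter = begin-strict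
        length R               <⟨ +-monoˡ-≤ (length R) nonempty ⟩
        length arcs + length R ≡⟨ length-++ arcs ⟨
        length (arcs ++ R)     ≡⟨ ↭-length P↭C++R ⟨
        length P               ∎
      cycle-part : diagonalCost (sources arcs) ≤ cost arcs
      cycle-part = cycle-bound optimal arcs sources-unique balanced
      rest-part : diagonalCost (sources R) ≤ cost R
      rest-part = go R (shorter R-shorter) R-balanced

module _ (G H : Graph) where

  ⊠-adj₂ : ∀ {x x′ y y′} → ClosedNbr G x x′ → Adj H y y′ → Adj (G ⊠ H) (x , y) (x′ , y′)
  ⊠-adj₂ x∼x′ y~y′ = adj⇒≢ H y~y′ ∘ cong proj₂ , x∼x′ , inj₂ y~y′

  ⊠-closedNbr : ∀ {x x′ y y′} → ClosedNbr G x x′ → ClosedNbr H y y′ →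
                ClosedNbr (G ⊠ H) (x , y) (x′ , y′)
  ⊠-closedNbr (inj₁ refl) (inj₁ refl) = inj₁ refl
  ⊠-closedNbr x∼x′        (inj₂ y~y′) = inj₂ (⊠-adj₂ x∼x′ y~y′)
  ⊠-closedNbr (inj₂ x~x′) y∼y′        = inj₂ (adj⇒≢ G x~x′ ∘ cong proj₁ , inj₂ x~x′ , y∼y′)

  ⊠-closedNbr-proj₂ : ∀ {p q} → ClosedNbr (G ⊠ H) p q → ClosedNbr H (proj₂ p) (proj₂ q)
  ⊠-closedNbr-proj₂ (inj₁ refl)         = inj₁ refl
  ⊠-closedNbr-proj₂ (inj₂ (_ , _ , y∼)) = y∼

  ⊠-walk-lift : ∀ x {a b k} → Walk H a b k → Walk (G ⊠ H) (x , a) (x , b) k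
  ⊠-walk-lift x here         = here
  ⊠-walk-lift x (step a~ w) = step (⊠-adj₂ (inj₁ refl) a~) (⊠-walk-lift x w)

  ⊠-walk-proj₂ : ∀ {p q m} → Walk (G ⊠ H) p q m → ∃[ m′ ] m′ ≤ m × Walk H (proj₂ p) (proj₂ q) m′
  ⊠-walk-proj₂ here = 0 , z≤n , here
  ⊠-walk-proj₂ (step (_ , _ , inj₁ refl) w) =
    let m′ , m′≤m , w′ = ⊠-walk-proj₂ w in m′ , m≤n⇒m≤1+n m′≤m , w′
  ⊠-walk-proj₂ (step (_ , _ , inj₂ a~) w) =
    let m′ , m′≤m , w′ = ⊠-walk-proj₂ w in suc m′ , s≤s m′≤m , step a~ w′

  ⊠-dist-lift : ∀ x {a b k} → Dist H a b k → Dist (G ⊠ H) (x , a) (x , b) k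
  ⊠-dist-lift x (w , minimal) = ⊠-walk-lift x w , λ m m<k w′ →
    let m′ , m′≤m , w″ = ⊠-walk-proj₂ w′ in minimal m′ (≤-<-trans m′≤m m<k) w″

  ⊠-dist-proj₂-≤ : ∀ {p q d k} → Dist H (proj₂ p) (proj₂ q) d → Dist (G ⊠ H) p q k → d ≤ k
  ⊠-dist-proj₂-≤ d (w , _) = let m′ , m′≤k , w′ = ⊠-walk-proj₂ w in ≤-trans (dist-≤-walk d w′) m′≤k

  ⊠-PairCost : ∀ X {as bs c} → PairCost H as bs c →
               PairCost (G ⊠ H) (cartesianProduct X as) (cartesianProduct X bs) (length X * c)
  ⊠-PairCost []      _  = nil
  ⊠-PairCost (x ∷ X) pc = PairCost-++ (row pc) (⊠-PairCost X pc)
    where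
    row : ∀ {as bs c} → PairCost H as bs c → PairCost (G ⊠ H) (map (x ,_) as) (map (x ,_) bs) c
    row nil         = nil
    row (cons d pc) = cons (⊠-dist-lift x d) (row pc)

  ⊠-Enumerates : ∀ {P : V G → Set} {Q : V H → Set} {xs ys} → Enumerates G P xs → Enumerates H Q ys →
                 Enumerates (G ⊠ H) (λ (x , y) → P x × Q y) (cartesianProduct xs ys)
  ⊠-Enumerates {xs = xs} {ys} (xs! , ∈xs⇔P) (ys! , ∈ys⇔Q) =
    Unique.cartesianProduct⁺ xs! ys! , λ (x , y) → mk⇔
      (λ xy∈ → let x∈ , y∈ = ∈-cartesianProduct⁻ xs ys xy∈ in to (∈xs⇔P x) x∈ , to (∈ys⇔Q y) y∈)
      (λ (Px , Qy) → ∈-cartesianProduct⁺ (from (∈xs⇔P x) Px) (from (∈ys⇔Q y) Qy))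

  ⊠-InR : ∀ {u₁ u₂ v₁ v₂} → Twins G u₁ u₂ → Adj H v₁ v₂ →
          ∀ z → InR (G ⊠ H) (u₁ , v₁) (u₂ , v₂) z ⇔ (ClosedNbr G u₁ (proj₁ z) × InR H v₁ v₂ (proj₂ z))
  ⊠-InR {u₁} {u₂} {v₁} {v₂} twins v₁~v₂ (x , y) = mk⇔ ⇒ ⇐
    where
    ⇒ : InR (G ⊠ H) (u₁ , v₁) (u₂ , v₂) (x , y) → ClosedNbr G u₁ x × InR H v₁ v₂ y
    ⇒ r with (_ , x∼ , y∼) , z∉N[u₂,v₂] ← to (InR⇔ (G ⊠ H)) r =
      x∼ , from (InR⇔ H) (v₁~y y∼ , y∉N[v₂])
      where
      y∉N[v₂] : ¬ ClosedNbr H v₂ y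
      y∉N[v₂] = z∉N[u₂,v₂] ∘ ⊠-closedNbr (to (twins x) x∼)
      v₁~y : ClosedNbr H v₁ y → Adj H v₁ y
      v₁~y (inj₁ refl) = contradiction (inj₂ (adj-sym H v₁~v₂)) y∉N[v₂]
      v₁~y (inj₂ v₁~y) = v₁~y
    ⇐ : ClosedNbr G u₁ x × InR H v₁ v₂ y → InR (G ⊠ H) (u₁ , v₁) (u₂ , v₂) (x , y)
    ⇐ (x∼ , r) with v₁~y , y∉N[v₂] ← to (InR⇔ H) r =
      from (InR⇔ (G ⊠ H)) (⊠-adj₂ x∼ v₁~y , y∉N[v₂] ∘ ⊠-closedNbr-proj₂)

module TwinProduct (G H : Graph) {x₁ x₂ : V G} (twins : Twins G x₁ x₂)
                   {y₁ y₂ : V H} (y₁~y₂ : Adj H y₁ y₂)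
                   {X : List (V G)} (X-enum : Enumerates G (ClosedNbr G x₁) X) where

  private
    K : Graph
    K = G ⊠ H

  Rˡ-Enumerates : ∀ {as} → Enumerates H (InR H y₁ y₂) as →
                  Enumerates K (InR K (x₁ , y₁) (x₂ , y₂)) (cartesianProduct X as)
  Rˡ-Enumerates as-enum = Enumerates-⇔ K (⇔-sym ∘ ⊠-InR G H twins y₁~y₂) (⊠-Enumerates G H X-enum as-enum)

  Rʳ-Enumerates : ∀ {bs} → Enumerates H (InR H y₂ y₁) bs →
                  Enumerates K (InR K (x₂ , y₂) (x₁ , y₁)) (cartesianProduct X bs)
  Rʳ-Enumerates bs-enum = Enumerates-⇔ K (⇔-sym ∘ ⊠-InR G H (⇔-sym ∘ twins) (adj-sym H y₁~y₂))
                                       (⊠-Enumerates G H (Enumerates-⇔ G twins X-enum) bs-enum)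

  upper-bound : ∀ {as bs c} → Enumerates H (InR H y₁ y₂) as → Enumerates H (InR H y₂ y₁) bs →
                PairCost H as bs c → AssignCost K (x₁ , y₁) (x₂ , y₂) (length X * c)
  upper-bound as-enum bs-enum pc = _ , _ , Rˡ-Enumerates as-enum , Rʳ-Enumerates bs-enum , ⊠-PairCost G H X pc

  module _ {n} {fa fb : Fin n → V H}
           (as-enum : Enumerates H (InR H y₁ y₂) (tabulate fa))
           (bs-enum : Enumerates H (InR H y₂ y₁) (tabulate fb)) where

    ¬¬-distances : ¬ ¬ (Σ (Fin n → Fin n → ℕ) λ D → ∀ i j → Dist H (fa i) (fb j) (D i j))
    ¬¬-distances = ¬¬-map (λ dist → (λ i j → proj₁ (dist i j)) , (λ i j → proj₂ (dist i j)))
                          (¬¬-Π-Fin λ i → ¬¬-Π-Fin λ j → ¬¬-dist (walk i j))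
      where
      walk : ∀ i j → Walk H (fa i) (fb j) 3
      walk i j = step (adj-sym H (proj₁ (to (proj₂ as-enum (fa i)) (∈-tabulate⁺ i))))
                   (step y₁~y₂ (step (proj₁ (to (proj₂ bs-enum (fb j)) (∈-tabulate⁺ j))) here))

    module _ {D : Fin n → Fin n → ℕ} (dist : ∀ i j → Dist H (fa i) (fb j) (D i j)) where

      open DiagonalAssignment D

      arcs-PairCost : ∀ Q → PairCost H (map fa (sources Q)) (map fb (targets Q)) (cost Q)
      arcs-PairCost []            = nil
      arcs-PairCost ((i , j) ∷ Q) = cons (dist i j) (arcs-PairCost Q)

      PairCost-diagonal : ∀ {c} → PairCost H (tabulate fa) (tabulate fb) c → c ≡ diagonalCost (allFin n)
      PairCost-diagonal pc = trans (PairCost-unique pc diagonal-PairCost) (cost-loops (allFin n))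
        where
        diagonal-PairCost : PairCost H (tabulate fa) (tabulate fb) (cost (loops (allFin n)))
        diagonal-PairCost = subst₂ (λ as bs → PairCost H as bs _)
          (trans (cong (map fa) (sources-loops (allFin n))) (map-tabulate id fa))
          (trans (cong (map fb) (targets-loops (allFin n))) (map-tabulate id fb))
          (arcs-PairCost (loops (allFin n)))

      diagonal-optimal : ∀ {c} → PairCost H (tabulate fa) (tabulate fb) c →
                         (∀ c′ → AssignCost H y₁ y₂ c′ → c ≤ c′) → DiagonalOptimal
      diagonal-optimal pc c-minimal Q (sources↭ , targets↭) = subst (_≤ cost Q) (PairCost-diagonal pc)
        (c-minimal (cost Q) (_ , _ , Enumerates-↭ H as-enum (↭-sym (tabulate-↭ fa sources↭)) ,
                                     Enumerates-↭ H bs-enum (↭-sym (tabulate-↭ fb targets↭)) , arcs-PairCost Q))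

      pairing-arcs : ∀ {xs ys k} → PairCost K xs ys k →
                     All (λ z → proj₂ z ∈ tabulate fa) xs → All (λ z → proj₂ z ∈ tabulate fb) ys →
                     Σ (List Arc) λ P → map fa (sources P) ≡ map proj₂ xs ×
                                        map fb (targets P) ≡ map proj₂ ys × cost P ≤ k
      pairing-arcs nil [] [] = [] , refl , refl , z≤n
      pairing-arcs (cons d pc) (x∈ ∷ xs∈) (y∈ ∷ ys∈)
        with i , x≡ ← ∈-tabulate⁻ x∈
           | j , y≡ ← ∈-tabulate⁻ y∈
           | P , P-sources , P-targets , P≤ ← pairing-arcs pc xs∈ ys∈ =
        (i , j) ∷ P , cong₂ _∷_ (sym x≡) P-sources , cong₂ _∷_ (sym y≡) P-targets ,
        +-mono-≤ (⊠-dist-proj₂-≤ G H (subst₂ (λ a b → Dist H a b (D i j)) (sym x≡) (sym y≡) (dist i j)) d) P≤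

      assignment-arcs : ∀ {c′} → AssignCost K (x₁ , y₁) (x₂ , y₂) c′ →
                        Σ (List Arc) λ P → sources P ↭ copies (length X) (allFin n) ×
                                           targets P ↭ copies (length X) (allFin n) × cost P ≤ c′
      assignment-arcs (_ , _ , as′-enum , bs′-enum , pc′)
        with as′↭ ← Enumerates-unique K as′-enum (Rˡ-Enumerates as-enum)
           | bs′↭ ← Enumerates-unique K bs′-enum (Rʳ-Enumerates bs-enum)
        with P , P-sources , P-targets , P≤ ← pairing-arcs pc′ (proj₂-∈-cartesianProduct X as′↭)
                                                               (proj₂-∈-cartesianProduct X bs′↭) =
        P , indices-↭-copies X fa (proj₁ as-enum) P-sources as′↭ ,
            indices-↭-copies X fb (proj₁ bs-enum) P-targets bs′↭ , P≤

      diagonal-lower-bound : DiagonalOptimal → ∀ {c′} → AssignCost K (x₁ , y₁) (x₂ , y₂) c′ →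
                     length X * diagonalCost (allFin n) ≤ c′
      diagonal-lower-bound optimal {c′} assignment
        with P , sources↭ , targets↭ , P≤ ← assignment-arcs assignment = begin
        length X * diagonalCost (allFin n)          ≡⟨ sum-map-copies _ (length X) (allFin n) ⟨
        diagonalCost (copies (length X) (allFin n)) ≡⟨ sum-map-↭ _ sources↭ ⟨
        diagonalCost (sources P)                    ≤⟨ balanced-bound optimal P (↭-trans sources↭ (↭-sym targets↭)) ⟩
        cost P                                      ≤⟨ P≤ ⟩
        c′                                          ∎
        where open ≤-Reasoning

  lower-bound : ∀ {c} → AssignCost H y₁ y₂ c → (∀ c′ → AssignCost H y₁ y₂ c′ → c ≤ c′) →
                ∀ c′ → AssignCost K (x₁ , y₁) (x₂ , y₂) c′ → length X * c ≤ c′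
  lower-bound {c} assignment c-minimal c′ assignment′
    with _ , fa , fb , as-enum , bs-enum , pc ← AssignCost-tabulate H assignment =
    decidable-stable (length X * c ≤? c′) (¬¬-map bound (¬¬-distances as-enum bs-enum))
    where
    bound : (Σ (Fin _ → Fin _ → ℕ) λ D → ∀ i j → Dist H (fa i) (fb j) (D i j)) → length X * c ≤ c′
    bound (_ , dist) = subst (λ c → length X * c ≤ c′) (sym (PairCost-diagonal as-enum bs-enum dist pc))
      (diagonal-lower-bound as-enum bs-enum dist (diagonal-optimal as-enum bs-enum dist pc c-minimal) assignment′)

lemma1 : (G H : Graph) (dG dH : ℕ) → Regular G dG → Regular H dH →
         (x₁ x₂ : V G) → (∀ w → ClosedNbr G x₁ w ⇔ ClosedNbr G x₂ w) →
         (y₁ y₂ : V H) → Adj H y₁ y₂ →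
         (c : ℕ) → IsOPT H y₁ y₂ c →
         IsOPT (G ⊠ H) (x₁ , y₁) (x₂ , y₂) ((dG + 1) * c)
lemma1 G H dG _ regular-G _ x₁ x₂ twins y₁ y₂ y₁~y₂ c
       (_ , assignment@(_ , _ , as-enum , bs-enum , pc) , c-minimal)
  with nbrs , nbrs-enum , |nbrs|≡dG ← regular-G x₁ =
  adjacent ,
  subst (AssignCost (G ⊠ H) _ _) |N[x₁]|*c≡ (upper-bound as-enum bs-enum pc) ,
  λ c′ assignment′ → subst (_≤ c′) |N[x₁]|*c≡ (lower-bound assignment c-minimal c′ assignment′)
  where
  open TwinProduct G H twins y₁~y₂ (Enumerates-closedNbr G nbrs-enum)
  adjacent : Adj (G ⊠ H) (x₁ , y₁) (x₂ , y₂)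
  adjacent = ⊠-adj₂ G H (from (twins x₂) (inj₁ refl)) y₁~y₂
  |N[x₁]|*c≡ : length (x₁ ∷ nbrs) * c ≡ (dG + 1) * c
  |N[x₁]|*c≡ = cong (_* c) (trans (cong suc |nbrs|≡dG) (+-comm 1 dG))
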